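{- Let $n,k\ge0$ and let $\lambda/\mu$ be a horizontal strip with $\lambda\vdash n$. Then $\mathcal{E}_{\lambda/\mu}(k)$ is a polynomial in $q$ with nonnegative integer coefficients.
   Context: Partitions are drawn as Young diagrams in English notation; the cell in row $i$, column $j$ has content $j-i$. For partitions $\mu\subseteq\lambda$ the skew diagram $\lambda/\mu$ consists of the cells of $\lambda$ not in $\mu$; it is a horizontal strip if no two of its cells lie in the same column. For integers $a$ let $[a]_q=(1-q^a)/(1-q)$. Let $\lambda\vdash n$, $\mu\vdash j$. Let $\mathfrak{t}^{\lambda/\mu}$ be the filling of the cells of $\lambda/\mu$ with $j+1,\dots,n$ in order, rows from top to bottom and within each row left to right; for $j<\ell\le n$ let $c_\ell$ be the content of the cell containing $\ell$. With $q$ an indeterminate, define $$\mathcal{E}_{\lambda/\mu}(k)=q^{nk-\binom k2}\sum_{j<\ell_1<\cdots<\ell_k\le n}\ \prod_{m=1}^k q^{ -\ell_m}\,[\ell_m+1-m+c_{\ell_m}]_q .$$ -}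

module Defs where

open import Data.Nat as ℕ using (ℕ; zero; suc; _≤_; _≥_; _<_)
open import Data.Nat.Combinatorics using (_C_)
open import Data.Integer as ℤ using (ℤ; +_; -[1+_])
open import Data.List using (List; []; _∷_; length; map; concatMap; lookup; foldr; _++_; upTo; applyUpTo)
open import Data.Nat.ListAction using (sum)
open import Data.Product using (_×_; _,_; proj₁; proj₂)
open import Relation.Binary.PropositionalEquality using (_≡_)
open import Relation.Nullary using (¬_)
open import Data.Bool using (if_then_else_)
open import Relation.Nullary.Decidable using (⌊_⌋)

part : List ℕ → ℕ → ℕ
part []       _       = 0
part (x ∷ xs) zero    = x
part (x ∷ xs) (suc i) = part xs i

data IsPartition : List ℕ → Set where
  []ᵖ  : IsPartition []
  [_]ᵖ : ∀ {x} → 1 ≤ x → IsPartition (x ∷ [])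
  _∷ᵖ_ : ∀ {x y ys} → y ≤ x → IsPartition (y ∷ ys) → IsPartition (x ∷ y ∷ ys)

_⊢_ : List ℕ → ℕ → Set
la ⊢ n = IsPartition la × sum la ≡ n

-- cell (i , j) (row i, column j, 0-indexed) lies in the Young diagram
InDiagram : List ℕ → ℕ → ℕ → Set
InDiagram la i j = j < part la i

_⊆ᵖ_ : List ℕ → List ℕ → Set
mu ⊆ᵖ la = ∀ i j → InDiagram mu i j → InDiagram la i j

InSkew : List ℕ → List ℕ → ℕ → ℕ → Set
InSkew la mu i j = InDiagram la i j × ¬ InDiagram mu i j

HorizontalStrip : List ℕ → List ℕ → Set
HorizontalStrip la mu =
  ∀ i i' j → InSkew la mu i j → InSkew la mu i' j → i ≡ i'

-- Laurent polynomials in q with integer coefficients, as formal sums of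
-- monomials (exponent , coefficient).

LPoly : Set
LPoly = List (ℤ × ℤ)

coeff : ℤ → LPoly → ℤ
coeff e []             = + 0
coeff e ((d , c) ∷ ps) = (if ⌊ d ℤ.≟ e ⌋ then c else + 0) ℤ.+ coeff e ps

_⊕_ : LPoly → LPoly → LPoly
p ⊕ r = p ++ r

_⊗_ : LPoly → LPoly → LPoly
p ⊗ r = concatMap (λ { (d , c) → map (λ { (d' , c') → (d ℤ.+ d' , c ℤ.* c') }) r }) p

one : LPoly
one = (+ 0 , + 1) ∷ []

qpow : ℤ → LPoly
qpow e = (e , + 1) ∷ []

-- [a]_q = (1 - q^a)/(1 - q), expanded:
--   a = m+1 > 0 : 1 + q + ... + q^m
--   a = 0       : 0
--   a = -(m+1)  : -(q^{-1} + q^{-2} + ... + q^{-(m+1)})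
qint : ℤ → LPoly
qint (+ m)     = applyUpTo (λ i → (+ i , + 1)) m
qint -[1+ m ]  = applyUpTo (λ i → (-[1+ i ] , -[1+ 0 ])) (suc m)

IsNNPoly : LPoly → Set
IsNNPoly p = (∀ e → e ℤ.< + 0 → coeff e p ≡ + 0) × (∀ e → + 0 ℤ.≤ coeff e p)

-- The filling t^{λ/μ}: contents of the cells of λ/μ in reading order
-- (rows top to bottom, each row left to right).  Content of (i , j) is j - i.

rowContents : ℕ → ℕ → ℕ → List ℤ
rowContents i a b = map (λ t → (+ (a ℕ.+ t)) ℤ.- (+ i)) (upTo (b ℕ.∸ a))

skewContentsFrom : ℕ → List ℕ → List ℕ → List ℤ
skewContentsFrom i []        mu = []
skewContentsFrom i (l ∷ la)  mu = rowContents i (part mu 0) l ++ skewContentsFrom (suc i) la (tailᵖ mu)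
  where
  tailᵖ : List ℕ → List ℕ
  tailᵖ []       = []
  tailᵖ (_ ∷ xs) = xs

-- c_{j+1}, c_{j+2}, ..., c_n  (j = |μ|)
skewContents : List ℕ → List ℕ → List ℤ
skewContents la mu = skewContentsFrom 0 la mu

-- pairs (ℓ , c_ℓ) for ℓ = j+1, ..., n
labelled : ℕ → List ℤ → List (ℕ × ℤ)
labelled s []       = []
labelled s (c ∷ cs) = (suc s , c) ∷ labelled (suc s) cs

choose : {A : Set} → ℕ → List A → List (List A)
choose zero    xs       = [] ∷ []
choose (suc k) []       = []
choose (suc k) (x ∷ xs) = map (x ∷_) (choose k xs) ++ choose (suc k) xs

-- ∏_{m} q^{-ℓ_m} [ℓ_m + 1 - m + c_{ℓ_m}]_q, with m starting at the given index
termFrom : ℕ → List (ℕ × ℤ) → LPoly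
termFrom m []             = one
termFrom m ((l , c) ∷ ls) =
  (qpow (ℤ.- (+ l)) ⊗ qint ((+ l) ℤ.+ (+ 1) ℤ.- (+ m) ℤ.+ c)) ⊗ termFrom (suc m) ls

sumL : List LPoly → LPoly
sumL = foldr _⊕_ []

𝓔 : List ℕ → List ℕ → ℕ → LPoly
𝓔 la mu k =
  qpow ((+ (n ℕ.* k)) ℤ.- (+ (k C 2)))
    ⊗ sumL (map (termFrom 1) (choose k (labelled (sum mu) (skewContents la mu))))
  where n = sum la

{-# OPTIONS --safe #-}
module Submission where

open import Defs
open import Data.Nat as ℕ using (ℕ; zero; suc; z≤n; s≤s)
import Data.Nat.Properties as ℕP
open import Data.Nat.Combinatorics using (_C_; nCk+nC[k+1]≡[n+1]C[k+1]; nC1≡n)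
open import Data.Nat.ListAction using (sum)
open import Algebra.Properties.CommutativeSemigroup ℕP.+-commutativeSemigroup using (interchange)
open import Data.Integer as ℤ using (ℤ; +_; +≤+)
import Data.Integer.Properties as ℤP
open import Data.List using (List; []; _∷_; length; map; upTo; _++_)
import Data.List.Properties as LP
open import Data.List.Relation.Unary.All as All using (All; []; _∷_)
open import Data.List.Relation.Unary.All.Properties using (map⁺; ++⁺; concat⁺; applyUpTo⁺₁)
open import Data.Product using (_×_; _,_; proj₁)
open import Data.Empty using (⊥-elim)
open import Relation.Binary.PropositionalEquality using (_≡_; refl; sym; trans; cong; cong₂; subst; module ≡-Reasoning)
open import Relation.Nullary using (yes; no)
open import Relation.Nullary.Decidable using (decidable-stable)
open import Function using (_∘_)

-- In the summand indexed by ℓ₁ < ⋯ < ℓₖ the argument aₘ = ℓₘ + 1 - m + c_{ℓₘ} of the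
-- m-th q-integer is nonnegative: ℓₘ ≥ j + m, and c_{ℓₘ} ≥ -j because in a horizontal
-- strip a cell of λ/μ in row i > 0 forces μ_{i-1} > μ_i, so i ≤ |μ| = j.  Hence every
-- factor has nonnegative coefficients and the summand has no exponent below -Σ ℓₘ.
-- Finally ℓₘ ≤ n - k + m gives Σ ℓₘ ≤ nk - (k choose 2), which the prefactor
-- q^{nk - (k choose 2)} compensates.

+m≤+o-+n : ∀ {m n o} → m ℕ.+ n ℕ.≤ o → + m ℤ.≤ + o ℤ.- + n
+m≤+o-+n {m} {n} {o} m+n≤o =
  subst (+ m ℤ.≤_) (sym (trans (ℤP.[+m]-[+n]≡m⊖n o n) (ℤP.⊖-≥ (ℕP.m+n≤o⇒n≤o m m+n≤o))))
    (+≤+ (ℕP.m+n≤o⇒m≤o∸n m m+n≤o))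

NonNegMonomialAbove : ℤ → ℤ × ℤ → Set
NonNegMonomialAbove d (e , c) = d ℤ.≤ e × + 0 ℤ.≤ c

NonNegAbove : ℤ → LPoly → Set
NonNegAbove d = All (NonNegMonomialAbove d)

NonNegAbove-weaken : ∀ {d d' p} → d' ℤ.≤ d → NonNegAbove d p → NonNegAbove d' p
NonNegAbove-weaken d'≤d = All.map (λ (d≤e , 0≤c) → ℤP.≤-trans d'≤d d≤e , 0≤c)

NonNegAbove-⊗ : ∀ {d d' p r} → NonNegAbove d p → NonNegAbove d' r → NonNegAbove (d ℤ.+ d') (p ⊗ r)
NonNegAbove-⊗ hp hr = concat⁺ (map⁺ (All.map (λ m → map⁺ (All.map (times m) hr)) hp))
  where
  times : ∀ {d d' e c e' c'} → NonNegMonomialAbove d (e , c) → NonNegMonomialAbove d' (e' , c') →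
    NonNegMonomialAbove (d ℤ.+ d') (e ℤ.+ e' , c ℤ.* c')
  times {c = + a} {c' = + b} (d≤e , _) (d'≤e' , _) =
    ℤP.+-mono-≤ d≤e d'≤e' , subst (+ 0 ℤ.≤_) (ℤP.pos-* a b) (+≤+ z≤n)

NonNegAbove-sumL : ∀ {d ps} → All (NonNegAbove d) ps → NonNegAbove d (sumL ps)
NonNegAbove-sumL []       = []
NonNegAbove-sumL (h ∷ hs) = ++⁺ h (NonNegAbove-sumL hs)

NonNegAbove-qpow : ∀ e → NonNegAbove e (qpow e)
NonNegAbove-qpow e = (ℤP.≤-refl , +≤+ z≤n) ∷ []

NonNegAbove-qint : ∀ {a} → + 0 ℤ.≤ a → NonNegAbove (+ 0) (qint a)
NonNegAbove-qint {+ a} _ = applyUpTo⁺₁ _ a (λ _ → +≤+ z≤n , +≤+ z≤n)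

coeff-below : ∀ {d p} → NonNegAbove d p → ∀ e → e ℤ.< d → coeff e p ≡ + 0
coeff-below [] e e<d = refl
coeff-below {p = (e' , c) ∷ p} ((d≤e' , _) ∷ h) e e<d with e' ℤ.≟ e
... | yes refl = ⊥-elim (ℤP.<-irrefl refl (ℤP.<-≤-trans e<d d≤e'))
... | no _     = trans (ℤP.+-identityˡ (coeff e p)) (coeff-below h e e<d)

coeff-nonNeg : ∀ {d p} → NonNegAbove d p → ∀ e → + 0 ℤ.≤ coeff e p
coeff-nonNeg [] e = ℤP.≤-refl
coeff-nonNeg {p = (e' , c) ∷ p} ((_ , 0≤c) ∷ h) e with e' ℤ.≟ e
... | yes refl = ℤP.+-mono-≤ 0≤c (coeff-nonNeg h e)
... | no _     = ℤP.+-mono-≤ (ℤP.≤-refl {+ 0}) (coeff-nonNeg h e)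

NonNegAbove⇒IsNNPoly : ∀ {p} → NonNegAbove (+ 0) p → IsNNPoly p
NonNegAbove⇒IsNNPoly h = coeff-below h , coeff-nonNeg h

labelSum : List (ℕ × ℤ) → ℕ
labelSum ls = sum (map proj₁ ls)

0≤+x-+y+c : ∀ {x y b c} → y ℕ.+ b ℕ.≤ x → ℤ.- + b ℤ.≤ c → + 0 ℤ.≤ + x ℤ.- + y ℤ.+ c
0≤+x-+y+c {x} {y} {b} y+b≤x -b≤c =
  ℤP.≤-trans (ℤP.i≤j⇒0≤j-i (+m≤+o-+n {b} {y} (subst (ℕ._≤ x) (ℕP.+-comm y b) y+b≤x)))
             (ℤP.+-monoʳ-≤ (+ x ℤ.- + y) -b≤c)

NonNegAbove-termFrom-∷ : ∀ {m l c ls} → + 0 ℤ.≤ + l ℤ.+ + 1 ℤ.- + m ℤ.+ c →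
  NonNegAbove (ℤ.- + labelSum ls) (termFrom (suc m) ls) →
  NonNegAbove (ℤ.- + labelSum ((l , c) ∷ ls)) (termFrom m ((l , c) ∷ ls))
NonNegAbove-termFrom-∷ {m} {l} {c} {ls} 0≤a h =
  subst (λ d → NonNegAbove d (termFrom m ((l , c) ∷ ls))) exponent
    (NonNegAbove-⊗ (NonNegAbove-⊗ (NonNegAbove-qpow (ℤ.- + l)) (NonNegAbove-qint 0≤a)) h)
  where
  exponent : (ℤ.- + l ℤ.+ + 0) ℤ.+ ℤ.- + labelSum ls ≡ ℤ.- + labelSum ((l , c) ∷ ls)
  exponent = trans (cong (ℤ._+ ℤ.- + labelSum ls) (ℤP.+-identityʳ (ℤ.- + l)))
                   (sym (ℤP.neg-distrib-+ (+ l) (+ labelSum ls)))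

-- The next chosen label is at least s + 1, so the argument of its q-integer is at least s + 2 - m - b.
choose-NonNegAbove-termFrom : ∀ b k s m cs → m ℕ.+ b ℕ.≤ suc s ℕ.+ 1 → All (λ c → ℤ.- + b ℤ.≤ c) cs →
  All (λ ls → NonNegAbove (ℤ.- + labelSum ls) (termFrom m ls)) (choose k (labelled s cs))
choose-NonNegAbove-termFrom b zero    s m cs       _ _ = NonNegAbove-qpow (+ 0) ∷ []
choose-NonNegAbove-termFrom b (suc k) s m []       _ _ = []
choose-NonNegAbove-termFrom b (suc k) s m (c ∷ cs) m+b≤ (-b≤c ∷ -b≤cs) =
  ++⁺ (map⁺ (All.map (λ {ls} → NonNegAbove-termFrom-∷ {m} {suc s} {c} {ls} (0≤+x-+y+c m+b≤ -b≤c))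
                     (choose-NonNegAbove-termFrom b k (suc s) (suc m) cs (s≤s m+b≤) -b≤cs)))
      (choose-NonNegAbove-termFrom b (suc k) (suc s) m cs (ℕP.m≤n⇒m≤1+n m+b≤) -b≤cs)

[1+k]C2≡k+kC2 : ∀ k → suc k C 2 ≡ k ℕ.+ k C 2
[1+k]C2≡k+kC2 k = trans (sym (nCk+nC[k+1]≡[n+1]C[k+1] k 1)) (cong (ℕ._+ k C 2) (nC1≡n k))

-- The first conjunct only serves to carry the induction in choose-labelSumBound.
LabelSumBound : ℕ → ℕ → List ℤ → List (ℕ × ℤ) → Set
LabelSumBound k s cs ls = k ℕ.≤ length cs × labelSum ls ℕ.+ k C 2 ℕ.≤ (s ℕ.+ length cs) ℕ.* k

choose-labelSumBound : ∀ k s cs → All (LabelSumBound k s cs) (choose k (labelled s cs))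
choose-labelSumBound zero    s cs       = (z≤n , z≤n) ∷ []
choose-labelSumBound (suc k) s []       = []
choose-labelSumBound (suc k) s (c ∷ cs) =
  ++⁺ (map⁺ (All.map (λ {ls} → take {ls}) (choose-labelSumBound k (suc s) cs)))
      (All.map (λ {ls} → skip {ls}) (choose-labelSumBound (suc k) (suc s) cs))
  where
  open ℕP.≤-Reasoning
  N : ℕ
  N = suc s ℕ.+ length cs
  N≡ : N ≡ s ℕ.+ length (c ∷ cs)
  N≡ = sym (ℕP.+-suc s (length cs))
  take : ∀ {ls} → LabelSumBound k (suc s) cs ls → LabelSumBound (suc k) s (c ∷ cs) ((suc s , c) ∷ ls)
  take {ls} (k≤len , bound) = s≤s k≤len , (begin
    suc s ℕ.+ labelSum ls ℕ.+ suc k C 2       ≡⟨ cong (suc s ℕ.+ labelSum ls ℕ.+_) ([1+k]C2≡k+kC2 k) ⟩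
    suc s ℕ.+ labelSum ls ℕ.+ (k ℕ.+ k C 2)   ≡⟨ interchange (suc s) (labelSum ls) k (k C 2) ⟩
    (suc s ℕ.+ k) ℕ.+ (labelSum ls ℕ.+ k C 2) ≤⟨ ℕP.+-mono-≤ (ℕP.+-monoʳ-≤ (suc s) k≤len) bound ⟩
    N ℕ.+ N ℕ.* k                             ≡⟨ sym (ℕP.*-suc N k) ⟩
    N ℕ.* suc k                               ≡⟨ cong (ℕ._* suc k) N≡ ⟩
    (s ℕ.+ length (c ∷ cs)) ℕ.* suc k         ∎)
  skip : ∀ {ls} → LabelSumBound (suc k) (suc s) cs ls → LabelSumBound (suc k) s (c ∷ cs) ls
  skip {ls} (k<len , bound) =
    ℕP.m≤n⇒m≤1+n k<len , subst (λ x → labelSum ls ℕ.+ suc k C 2 ℕ.≤ x ℕ.* suc k) N≡ bound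

⊆ᵖ⇒part≤ : ∀ {la mu} → mu ⊆ᵖ la → ∀ r → part mu r ℕ.≤ part la r
⊆ᵖ⇒part≤ mu⊆la r = below⇒≤ (mu⊆la r)
  where
  below⇒≤ : ∀ {a b} → (∀ j → j ℕ.< a → j ℕ.< b) → a ℕ.≤ b
  below⇒≤ {zero}  _ = z≤n
  below⇒≤ {suc a} h = h a ℕP.≤-refl

part-antitone : ∀ {la} → IsPartition la → ∀ r → part la (suc r) ℕ.≤ part la r
part-antitone []ᵖ          r       = z≤n
part-antitone [ _ ]ᵖ       r       = z≤n
part-antitone (y≤x ∷ᵖ _)   zero    = y≤x
part-antitone (_ ∷ᵖ la)    (suc r) = part-antitone la r

IsPartition-head>0 : ∀ {x xs} → IsPartition (x ∷ xs) → 0 ℕ.< x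
IsPartition-head>0 [ 0<x ]ᵖ   = 0<x
IsPartition-head>0 (y≤x ∷ᵖ p) = ℕP.≤-trans (IsPartition-head>0 p) y≤x

0<part⇒<sum : ∀ {mu} → IsPartition mu → ∀ r → 0 ℕ.< part mu r → r ℕ.< sum mu
0<part⇒<sum ([_]ᵖ {x} _)  zero    0<x = ℕP.≤-trans 0<x (ℕP.m≤m+n x 0)
0<part⇒<sum (_∷ᵖ_ {x} _ _) zero    0<x = ℕP.≤-trans 0<x (ℕP.m≤m+n x _)
0<part⇒<sum (y≤x ∷ᵖ p)    (suc r) 0<y =
  ℕP.+-mono-≤ (ℕP.≤-trans (IsPartition-head>0 p) y≤x) (0<part⇒<sum p r 0<y)

-- The cells (r, μ_{r+1}) and (r+1, μ_{r+1}) would share a column unless μ_r > μ_{r+1}.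
horizontalStrip-row≤ : ∀ {la mu} → IsPartition la → IsPartition mu → HorizontalStrip la mu →
  ∀ r → part mu r ℕ.< part la r → r ℕ.≤ sum mu
horizontalStrip-row≤ pla pmu strip zero    _        = z≤n
horizontalStrip-row≤ {la} {mu} pla pmu strip (suc r) skewCell =
  0<part⇒<sum pmu r (ℕP.≤-<-trans z≤n μ[r+1]<μ[r])
  where
  μ[r+1]<μ[r] : part mu (suc r) ℕ.< part mu r
  μ[r+1]<μ[r] = decidable-stable (part mu (suc r) ℕ.<? part mu r) λ μ[r+1]≮μ[r] →
    ℕP.1+n≢n (sym (strip r (suc r) (part mu (suc r))
      (ℕP.<-≤-trans skewCell (part-antitone pla r) , μ[r+1]≮μ[r])
      (skewCell , ℕP.n≮n _)))

rowContents-≥ : ∀ {b} i a l → (a ℕ.< l → i ℕ.≤ b) → All (λ c → ℤ.- + b ℤ.≤ c) (rowContents i a l)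
rowContents-≥ i a l nonEmpty⇒i≤b = map⁺ (applyUpTo⁺₁ _ (l ℕ.∸ a) λ {t} t<l∸a →
  ℤP.≤-trans (ℤP.neg-mono-≤ (+≤+ (nonEmpty⇒i≤b (a<l t<l∸a)))) (ℤP.i≤j+i (ℤ.- + i) (+ (a ℕ.+ t))))
  where
  a<l : ∀ {t} → t ℕ.< l ℕ.∸ a → a ℕ.< l
  a<l {t} t<l∸a = ℕP.m∸n≢0⇒n<m (λ l∸a≡0 → ℕP.n≮0 (subst (t ℕ.<_) l∸a≡0 t<l∸a))

skewContentsFrom-≥ : ∀ {b} i la mu → (∀ r → part mu r ℕ.< part la r → i ℕ.+ r ℕ.≤ b) →
  All (λ c → ℤ.- + b ℤ.≤ c) (skewContentsFrom i la mu)
skewContentsFrom-≥     i []       mu       _ = []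
skewContentsFrom-≥ {b} i (l ∷ la) []       h =
  ++⁺ (rowContents-≥ i 0 l (subst (ℕ._≤ b) (ℕP.+-identityʳ i) ∘ h 0))
      (skewContentsFrom-≥ (suc i) la [] λ r → subst (ℕ._≤ b) (ℕP.+-suc i r) ∘ h (suc r))
skewContentsFrom-≥ {b} i (l ∷ la) (x ∷ mu) h =
  ++⁺ (rowContents-≥ i x l (subst (ℕ._≤ b) (ℕP.+-identityʳ i) ∘ h 0))
      (skewContentsFrom-≥ (suc i) la mu λ r → subst (ℕ._≤ b) (ℕP.+-suc i r) ∘ h (suc r))

parts≤0⇒sum≡0 : ∀ mu → (∀ r → part mu r ℕ.≤ 0) → sum mu ≡ 0
parts≤0⇒sum≡0 []       _ = refl
parts≤0⇒sum≡0 (x ∷ mu) h = cong₂ ℕ._+_ (ℕP.n≤0⇒n≡0 (h 0)) (parts≤0⇒sum≡0 mu (h ∘ suc))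

sum+length-row++ : ∀ i l la x xs → x ℕ.≤ l →
  sum xs ℕ.+ length (skewContentsFrom (suc i) la xs) ≡ sum la →
  (x ℕ.+ sum xs) ℕ.+ length (rowContents i x l ++ skewContentsFrom (suc i) la xs) ≡ l ℕ.+ sum la
sum+length-row++ i l la x xs x≤l rest = begin
  (x ℕ.+ sum xs) ℕ.+ length (rowContents i x l ++ skewContentsFrom (suc i) la xs)
    ≡⟨ cong ((x ℕ.+ sum xs) ℕ.+_) (trans (LP.length-++ (rowContents i x l)) (cong (ℕ._+ _) length-row)) ⟩
  (x ℕ.+ sum xs) ℕ.+ ((l ℕ.∸ x) ℕ.+ length (skewContentsFrom (suc i) la xs))
    ≡⟨ interchange x (sum xs) (l ℕ.∸ x) _ ⟩
  (x ℕ.+ (l ℕ.∸ x)) ℕ.+ (sum xs ℕ.+ length (skewContentsFrom (suc i) la xs))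
    ≡⟨ cong₂ ℕ._+_ (ℕP.m+[n∸m]≡n x≤l) rest ⟩
  l ℕ.+ sum la ∎
  where
  open ≡-Reasoning
  length-row : length (rowContents i x l) ≡ l ℕ.∸ x
  length-row = trans (LP.length-map _ (upTo (l ℕ.∸ x))) (LP.length-upTo (l ℕ.∸ x))

sum+length-skewContentsFrom : ∀ i la mu → (∀ r → part mu r ℕ.≤ part la r) →
  sum mu ℕ.+ length (skewContentsFrom i la mu) ≡ sum la
sum+length-skewContentsFrom i []       mu       h = trans (ℕP.+-identityʳ (sum mu)) (parts≤0⇒sum≡0 mu h)
sum+length-skewContentsFrom i (l ∷ la) []       h =
  sum+length-row++ i l la 0 [] z≤n (sum+length-skewContentsFrom (suc i) la [] (h ∘ suc))
sum+length-skewContentsFrom i (l ∷ la) (x ∷ mu) h =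
  sum+length-row++ i l la x mu (h 0) (sum+length-skewContentsFrom (suc i) la mu (h ∘ suc))

theorem5p12 : (n k : ℕ) (la mu : List ℕ) → la ⊢ n → IsPartition mu → mu ⊆ᵖ la →
    HorizontalStrip la mu → IsNNPoly (𝓔 la mu k)
theorem5p12 _ k la mu (pla , refl) pmu mu⊆la strip =
  NonNegAbove⇒IsNNPoly (subst (λ d → NonNegAbove d (𝓔 la mu k)) (ℤP.+-inverseʳ E)
    (NonNegAbove-⊗ (NonNegAbove-qpow E)
      (NonNegAbove-sumL (map⁺ (All.zipWith (λ {ls} → summand {ls}) (nonNeg , bounded))))))
  where
  E : ℤ
  E = + (sum la ℕ.* k) ℤ.- + (k C 2)
  j : ℕ
  j = sum mu
  cs : List ℤ
  cs = skewContents la mu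

  nonNeg : All (λ ls → NonNegAbove (ℤ.- + labelSum ls) (termFrom 1 ls)) (choose k (labelled j cs))
  nonNeg = choose-NonNegAbove-termFrom j k j 1 cs (ℕP.m≤m+n (suc j) 1)
    (skewContentsFrom-≥ 0 la mu (horizontalStrip-row≤ pla pmu strip))

  bounded : All (LabelSumBound k j cs) (choose k (labelled j cs))
  bounded = choose-labelSumBound k j cs

  |μ|+|λ/μ|≡|λ| : j ℕ.+ length cs ≡ sum la
  |μ|+|λ/μ|≡|λ| = sum+length-skewContentsFrom 0 la mu (⊆ᵖ⇒part≤ {la} {mu} mu⊆la)

  summand : ∀ {ls} → NonNegAbove (ℤ.- + labelSum ls) (termFrom 1 ls) × LabelSumBound k j cs ls →
    NonNegAbove (ℤ.- E) (termFrom 1 ls)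
  summand {ls} (nonNeg-ls , _ , bound) = NonNegAbove-weaken
    (ℤP.neg-mono-≤ (+m≤+o-+n (subst (λ N → labelSum ls ℕ.+ k C 2 ℕ.≤ N ℕ.* k) |μ|+|λ/μ|≡|λ| bound)))
    nonNeg-ls
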